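{- Let $r\ge 2$, $n\ge 2$, $0\le p_1\le\cdots\le p_n$, and set $S_0=0$, $S_m=\sum_{i=1}^m p_i$. Let $T$ be a complete $r$-ary tree with $n$ leaves. If the sequence $(i_0,i_1,\ldots,i_h)$ represents $T$, then the cost of $T$ equals $\sum_{k=1}^h S_{r i_k-i_{k-1}}$.
   Context: An $r$-ary tree is complete if every internal node has exactly $r$ children. Given $h$ at least the height of $T$, place the root of $T$ at level $h$ and each child one level below its parent; the sequence $(i_0,\dots,i_h)$ represents $T$ if for each $0\le k\le h$, $i_k$ is the number of internal nodes of $T$ at levels $\le k$. The cost of $T$ is the minimum, over all bijections assigning the weights $p_1,\dots,p_n$ to the leaves of $T$, of $\sum$ (weight of leaf) $\times$ (distance of the leaf from the root).
   Formalization: The weights $p_1,\dots,p_n$ are rational. -}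

module Defs where

open import Data.Nat as ℕ using (ℕ; zero; suc; _∸_; _⊔_; _≤?_)
open import Data.Fin using (Fin; toℕ)
open import Data.List using (List; []; _∷_; map; concat; tabulate; foldr; filter; length; take)
open import Data.Integer using (+_)
open import Data.Rational using (ℚ; 0ℚ; _+_; _*_; _/_)
open import Data.Fin.Permutation using (Permutation; _⟨$⟩ʳ_)
open import Data.List using (lookup)

data Tree (r : ℕ) : Set where
  leaf : Tree r
  node : (Fin r → Tree r) → Tree r

height : ∀ {r} → Tree r → ℕ
height leaf = 0
height (node f) = suc (foldr _⊔_ 0 (tabulate (λ j → height (f j))))

leafDepths : ∀ {r} → Tree r → List ℕ
leafDepths leaf = 0 ∷ []
leafDepths (node f) = map suc (concat (tabulate (λ j → leafDepths (f j))))

internalDepths : ∀ {r} → Tree r → List ℕ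
internalDepths leaf = []
internalDepths (node f) = 0 ∷ map suc (concat (tabulate (λ j → internalDepths (f j))))

-- number of internal nodes at level ≤ k, when the root is placed at level h
-- (a node at depth d sits at level h ∸ d; exact since h ≥ height)
internalUpTo : ∀ {r} → ℕ → Tree r → ℕ → ℕ
internalUpTo h T k = length (filter (λ l → l ≤? k) (map (h ∸_) (internalDepths T)))

-- the sequence i (only i 0 … i h matter) represents T for the given h
Represents : ∀ {r} → Tree r → (h : ℕ) → (ℕ → ℕ) → Set
Represents T h i = ∀ k → k ℕ.≤ h → i k ≡ internalUpTo h T k
  where open import Relation.Binary.PropositionalEquality using (_≡_)

sumℚ : List ℚ → ℚ
sumℚ = foldr _+_ 0ℚ

ℕtoℚ : ℕ → ℚ
ℕtoℚ d = + d / 1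

-- cost of the assignment π: weight p j is placed on leaf number π j
assignCost : ∀ {r n} (T : Tree r) (p : Fin n → ℚ) →
             Permutation n (length (leafDepths T)) → ℚ
assignCost T p π = sumℚ (tabulate (λ j → p j * ℕtoℚ (lookup (leafDepths T) (π ⟨$⟩ʳ j))))

-- S m = p_1 + … + p_m  (S 0 = 0); p is indexed from 0
S : ∀ {n} → (Fin n → ℚ) → ℕ → ℚ
S p m = sumℚ (take m (tabulate p))

formula : ∀ {n} (r : ℕ) (p : Fin n → ℚ) (h : ℕ) (i : ℕ → ℕ) → ℚ
formula r p h i = sumℚ (tabulate {n = h} (λ k → S p (r ℕ.* i (suc (toℕ k)) ∸ i (toℕ k))))

{-# OPTIONS --safe #-}
module Submission where

-- Writing each leaf depth d ≤ h as the number of levels k < h with h ∸ k ≤ d, the cost of an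
-- assignment becomes a sum over k of the total weight placed on the leaves of depth ≥ h ∸ k.
-- If there are c such leaves, that weight is at least S c because p is sorted, with equality
-- when the deepest leaves receive the smallest weights. Since the nodes at depth ≥ t + 1 are the
-- children of the internal nodes at depth ≥ t, counting them gives c = r i (k+1) ∸ i k.

open import Defs
open import Data.Nat as ℕ using (ℕ; zero; suc; _+_; _*_; _∸_; _≤_; _≥_; _≤ᵇ_; _≤?_; _⊓_; _⊔_; z≤n; s≤s)
import Data.Nat.Properties as ℕ
import Data.Nat.Coprimality as Coprime
open import Data.Bool using (Bool; true; false; T)
import Data.Bool.Properties as Bool
open import Data.Empty using (⊥-elim)
open import Data.Fin using (Fin; zero; suc; toℕ)
import Data.Fin as F
import Data.Fin.Properties as F
open import Data.Fin.Permutation using (Permutation; _⟨$⟩ʳ_; _∘ₚ_; transpose; lift₀; id)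
import Data.Integer as ℤ
import Data.Integer.Properties as ℤ
open import Data.List using (List; []; _∷_; _++_; map; concat; foldr; filter; length; tabulate; lookup; allFin)
open import Data.List.Relation.Unary.All as All using (All; []; _∷_)
import Data.List.Relation.Unary.All.Properties as All
open import Data.List.Membership.Propositional.Properties using (∈-allFin; ∈-lookup)
open import Data.List.Extrema.Nat using (argmax; f[xs]≤f[argmax])
open import Data.Product using (_×_; Σ; _,_; proj₁; proj₂)
open import Data.Rational using (ℚ; 0ℚ; 1ℚ; _/_)
import Data.Rational as Q
import Data.Rational.Properties as Q
open import Function using (_∘_)
open import Function.Bundles using (Equivalence)
open import Relation.Binary.Core using (_Preserves_⟶_)
open import Relation.Binary.PropositionalEquality
open import Relation.Nullary using (yes; no)
open import Relation.Nullary.Reflects as Reflects using (ofʸ; ofⁿ)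
open import Algebra.Bundles using (CommutativeRing)
import Algebra.Properties.Semiring.Sum as SemiringSum

module Σℕ = SemiringSum ℕ.+-*-semiring
open SemiringSum (CommutativeRing.semiring Q.+-*-commutativeRing)
  using (sum; sum-syntax; sum-cong-≗; ∑-comm; *-distribˡ-sum; sum-replicate-zero)

sumℚ-tabulate : ∀ {n} (f : Fin n → ℚ) → sumℚ (tabulate f) ≡ sum f
sumℚ-tabulate {zero} f = refl
sumℚ-tabulate {suc n} f = cong (f zero Q.+_) (sumℚ-tabulate (f ∘ suc))

sum-mono-≤ : ∀ {n} {f g : Fin n → ℚ} → (∀ j → f j Q.≤ g j) → sum f Q.≤ sum g
sum-mono-≤ {zero} f≤g = Q.≤-refl
sum-mono-≤ {suc n} f≤g = Q.+-mono-≤ (f≤g zero) (sum-mono-≤ (f≤g ∘ suc))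

∑-one : ∀ n → Σℕ.sum {n} (λ _ → 1) ≡ n
∑-one zero = refl
∑-one (suc n) = cong suc (∑-one n)

𝟙 : Bool → ℕ
𝟙 false = 0
𝟙 true = 1

𝟙ℚ : Bool → ℚ
𝟙ℚ false = 0ℚ
𝟙ℚ true = 1ℚ

ℕtoℚ-suc : ∀ d → ℕtoℚ (suc d) ≡ 1ℚ Q.+ ℕtoℚ d
ℕtoℚ-suc d rewrite Q.normalize-coprime {d} {0} (Coprime.sym (Coprime.1-coprimeTo d)) =
  cong (_/ 1) (cong (ℤ._+_ (ℤ.+ 1)) (sym (ℤ.*-identityʳ (ℤ.+ d))))

∑-𝟙-levels≡⊓ : ∀ h d → ∑[ k < h ] 𝟙ℚ (h ∸ toℕ k ≤ᵇ d) ≡ ℕtoℚ (h ⊓ d)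
∑-𝟙-levels≡⊓ zero d = refl
∑-𝟙-levels≡⊓ (suc h) d rewrite ∑-𝟙-levels≡⊓ h d with suc h ≤ᵇ d | ℕ.≤ᵇ-reflects-≤ (suc h) d
... | true  | ofʸ h<d rewrite ℕ.m≤n⇒m⊓n≡m h<d | ℕ.m≤n⇒m⊓n≡m (ℕ.<⇒≤ h<d) = sym (ℕtoℚ-suc h)
... | false | ofⁿ h≮d rewrite ℕ.m≥n⇒m⊓n≡n (ℕ.≮⇒≥ h≮d) | ℕ.m≥n⇒m⊓n≡n (ℕ.m≤n⇒m≤1+n (ℕ.≮⇒≥ h≮d)) =
  Q.+-identityˡ _

count : ∀ {n} → (Fin n → Bool) → ℕ
count b = Σℕ.sum (𝟙 ∘ b)

selectSum : ∀ {n} → (Fin n → ℚ) → (Fin n → Bool) → ℚ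
selectSum {n} p b = ∑[ j < n ] (p j Q.* 𝟙ℚ (b j))

DownwardClosed : ∀ {n} → (Fin n → Bool) → Set
DownwardClosed b = ∀ {j k} → j F.≤ k → T (b k) → T (b j)

count≤n : ∀ {n} (b : Fin n → Bool) → count b ≤ n
count≤n {zero} b = z≤n
count≤n {suc n} b with b zero
... | true  = s≤s (count≤n (b ∘ suc))
... | false = ℕ.m≤n⇒m≤1+n (count≤n (b ∘ suc))

count-none : ∀ {n} (b : Fin n → Bool) → (∀ j → b j ≡ false) → count b ≡ 0
count-none {n} b none = trans (Σℕ.sum-cong-≗ (cong 𝟙 ∘ none)) (Σℕ.sum-replicate-zero n)

selectSum-none : ∀ {n} (p : Fin n → ℚ) (b : Fin n → Bool) → (∀ j → b j ≡ false) → selectSum p b ≡ 0ℚ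
selectSum-none {n} p b none =
  trans (sum-cong-≗ (λ j → trans (cong (λ x → p j Q.* 𝟙ℚ x) (none j)) (Q.*-zeroʳ (p j))))
        (sum-replicate-zero n)

count-permute : ∀ {m n} (b : Fin m → Bool) (π : Permutation n m) → count (b ∘ (π ⟨$⟩ʳ_)) ≡ count b
count-permute b π = sym (Σℕ.sum-permute (𝟙 ∘ b) π)

S-≤-S-tail : ∀ {n} (p : Fin (suc n) → ℚ) → p Preserves F._≤_ ⟶ Q._≤_ →
             ∀ {c} → c ≤ n → S p c Q.≤ S (p ∘ suc) c
S-≤-S-tail p p-mono z≤n = Q.≤-refl
S-≤-S-tail p p-mono (s≤s c≤n) = Q.+-mono-≤ (p-mono z≤n) (S-≤-S-tail (p ∘ suc) (p-mono ∘ s≤s) c≤n)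

S-count≤selectSum : ∀ {n} (p : Fin n → ℚ) → p Preserves F._≤_ ⟶ Q._≤_ →
                    ∀ b → S p (count b) Q.≤ selectSum p b
S-count≤selectSum {zero} p p-mono b = Q.≤-refl
S-count≤selectSum {suc n} p p-mono b with b zero | S-count≤selectSum (p ∘ suc) (p-mono ∘ s≤s) (b ∘ suc)
... | true  | ih rewrite Q.*-identityʳ (p zero) = Q.+-monoʳ-≤ (p zero) ih
... | false | ih rewrite Q.*-zeroʳ (p zero) | Q.+-identityˡ (selectSum (p ∘ suc) (b ∘ suc)) =
  Q.≤-trans (S-≤-S-tail p p-mono (count≤n (b ∘ suc))) ih

S-count≡selectSum : ∀ {n} (p : Fin n → ℚ) (b : Fin n → Bool) → DownwardClosed b →
                    S p (count b) ≡ selectSum p b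
S-count≡selectSum {zero} p b b-closed = refl
S-count≡selectSum {suc n} p b b-closed with b zero Bool.≟ true
... | yes b₀ = begin
  S p (𝟙 (b zero) + count (b ∘ suc))
    ≡⟨ cong (λ x → S p (𝟙 x + count (b ∘ suc))) b₀ ⟩
  p zero Q.+ S (p ∘ suc) (count (b ∘ suc))
    ≡⟨ cong₂ Q._+_ (sym (Q.*-identityʳ (p zero))) (S-count≡selectSum (p ∘ suc) (b ∘ suc) (b-closed ∘ s≤s)) ⟩
  p zero Q.* 1ℚ Q.+ selectSum (p ∘ suc) (b ∘ suc)
    ≡⟨ cong (λ x → p zero Q.* 𝟙ℚ x Q.+ selectSum (p ∘ suc) (b ∘ suc)) b₀ ⟨
  selectSum p b ∎
  where open ≡-Reasoning
... | no ¬b₀ = trans (cong (S p) (count-none b none)) (sym (selectSum-none p b none))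
  where
  none : ∀ j → b j ≡ false
  none j with b j | b-closed {zero} {j} z≤n
  ... | false | _ = refl
  ... | true  | b₀-holds = ⊥-elim (¬b₀ (Bool.T-≡ .Equivalence.to (b₀-holds _)))

sortDescending : ∀ m (d : Fin m → ℕ) → Σ (Permutation m m) λ σ → (d ∘ (σ ⟨$⟩ʳ_)) Preserves F._≤_ ⟶ _≥_
sortDescending zero d = id , λ { {()} }
sortDescending (suc m) d = σ , σ-sorted
  where
  i = argmax d zero (allFin (suc m))
  i-max : ∀ j → d j ≤ d i
  i-max j = All.lookup (f[xs]≤f[argmax] {f = d} zero (allFin (suc m))) (∈-allFin j)
  rest = sortDescending m (d ∘ (transpose zero i ⟨$⟩ʳ_) ∘ suc)
  σ = lift₀ (proj₁ rest) ∘ₚ transpose zero i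
  σ-sorted : (d ∘ (σ ⟨$⟩ʳ_)) Preserves F._≤_ ⟶ _≥_
  σ-sorted {zero}  _                 = i-max _
  σ-sorted {suc j} {suc k} (s≤s j≤k) = proj₂ rest j≤k

layer-cake : ∀ {n} h (p : Fin n → ℚ) (d : Fin n → ℕ) → (∀ j → d j ≤ h) →
  ∑[ j < n ] (p j Q.* ℕtoℚ (d j)) ≡ ∑[ k < h ] selectSum p (λ j → h ∸ toℕ k ≤ᵇ d j)
layer-cake {n} h p d d≤h = begin
  ∑[ j < n ] (p j Q.* ℕtoℚ (d j))
    ≡⟨ sum-cong-≗ {n} (λ j → cong (p j Q.*_) (depth-by-levels j)) ⟩
  ∑[ j < n ] (p j Q.* ∑[ k < h ] 𝟙ℚ (h ∸ toℕ k ≤ᵇ d j))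
    ≡⟨ sum-cong-≗ {n} (λ j → *-distribˡ-sum {h} (p j) (λ k → 𝟙ℚ (h ∸ toℕ k ≤ᵇ d j))) ⟩
  ∑[ j < n ] ∑[ k < h ] (p j Q.* 𝟙ℚ (h ∸ toℕ k ≤ᵇ d j))
    ≡⟨ ∑-comm {n} {h} (λ j k → p j Q.* 𝟙ℚ (h ∸ toℕ k ≤ᵇ d j)) ⟩
  ∑[ k < h ] selectSum p (λ j → h ∸ toℕ k ≤ᵇ d j) ∎
  where
  open ≡-Reasoning
  depth-by-levels : ∀ j → ℕtoℚ (d j) ≡ ∑[ k < h ] 𝟙ℚ (h ∸ toℕ k ≤ᵇ d j)
  depth-by-levels j = sym (trans (∑-𝟙-levels≡⊓ h (d j)) (cong ℕtoℚ (ℕ.m≥n⇒m⊓n≡n (d≤h j))))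

#≥ : ℕ → List ℕ → ℕ
#≥ t [] = 0
#≥ t (d ∷ ds) = 𝟙 (t ≤ᵇ d) + #≥ t ds

#≥-++ : ∀ t xs ys → #≥ t (xs ++ ys) ≡ #≥ t xs + #≥ t ys
#≥-++ t [] ys = refl
#≥-++ t (x ∷ xs) ys = trans (cong (𝟙 (t ≤ᵇ x) +_) (#≥-++ t xs ys)) (sym (ℕ.+-assoc (𝟙 (t ≤ᵇ x)) _ _))

#≥-concat-tabulate : ∀ {r} t (g : Fin r → List ℕ) → #≥ t (concat (tabulate g)) ≡ Σℕ.sum (λ j → #≥ t (g j))
#≥-concat-tabulate {zero} t g = refl
#≥-concat-tabulate {suc r} t g =
  trans (#≥-++ t (g zero) _) (cong (#≥ t (g zero) +_) (#≥-concat-tabulate t (g ∘ suc)))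

suc-≤ᵇ-suc : ∀ t d → (suc t ≤ᵇ suc d) ≡ (t ≤ᵇ d)
suc-≤ᵇ-suc zero d = refl
suc-≤ᵇ-suc (suc t) d = refl

#≥-map-suc : ∀ t xs → #≥ (suc t) (map suc xs) ≡ #≥ t xs
#≥-map-suc t [] = refl
#≥-map-suc t (x ∷ xs) = cong₂ _+_ (cong 𝟙 (suc-≤ᵇ-suc t x)) (#≥-map-suc t xs)

#≥-0-map-suc : ∀ xs → #≥ 0 (map suc xs) ≡ #≥ 1 (map suc xs)
#≥-0-map-suc [] = refl
#≥-0-map-suc (x ∷ xs) = cong suc (#≥-0-map-suc xs)

#≥-lookup : ∀ t xs → count (λ ℓ → t ≤ᵇ lookup xs ℓ) ≡ #≥ t xs
#≥-lookup t [] = refl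
#≥-lookup t (x ∷ xs) = cong (𝟙 (t ≤ᵇ x) +_) (#≥-lookup t xs)

∸-≤-swap : ∀ h x k → h ∸ x ≤ k → h ∸ k ≤ x
∸-≤-swap h x k h∸x≤k = ℕ.m≤n+o⇒m∸n≤o h k (begin
  h            ≤⟨ ℕ.m≤n+m∸n h x ⟩
  x + (h ∸ x)  ≤⟨ ℕ.+-monoʳ-≤ x h∸x≤k ⟩
  x + k        ≡⟨ ℕ.+-comm x k ⟩
  k + x        ∎)
  where open ℕ.≤-Reasoning

∸-≤ᵇ-swap : ∀ h x k → (h ∸ x ≤ᵇ k) ≡ (h ∸ k ≤ᵇ x)
∸-≤ᵇ-swap h x k = Reflects.det (ℕ.≤ᵇ-reflects-≤ (h ∸ x) k)
  (Reflects.fromEquivalence (∸-≤-swap h k x ∘ ℕ.≤ᵇ⇒≤ (h ∸ k) x) (ℕ.≤⇒≤ᵇ ∘ ∸-≤-swap h x k))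

length-filter-≤-map-∸ : ∀ h k ds → length (filter (_≤? k) (map (h ∸_) ds)) ≡ #≥ (h ∸ k) ds
length-filter-≤-map-∸ h k [] = refl
length-filter-≤-map-∸ h k (x ∷ ds) rewrite ∸-≤ᵇ-swap h x k with h ∸ k ≤ᵇ x
... | true  = cong suc (length-filter-≤-map-∸ h k ds)
... | false = length-filter-≤-map-∸ h k ds

g≤foldr-⊔-tabulate : ∀ {r} (g : Fin r → ℕ) j → g j ≤ foldr _⊔_ 0 (tabulate g)
g≤foldr-⊔-tabulate g zero = ℕ.m≤m⊔n (g zero) _
g≤foldr-⊔-tabulate g (suc j) = ℕ.≤-trans (g≤foldr-⊔-tabulate (g ∘ suc) j) (ℕ.m≤n⊔m (g zero) _)

leafDepths≤height : ∀ {r} (T : Tree r) → All (_≤ height T) (leafDepths T)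
leafDepths≤height leaf = z≤n ∷ []
leafDepths≤height (node f) = All.map⁺ (All.concat⁺ (All.tabulate⁺ λ j →
  All.map (λ d≤ → s≤s (ℕ.≤-trans d≤ (g≤foldr-⊔-tabulate (height ∘ f) j))) (leafDepths≤height (f j))))

module _ {r : ℕ} where

  #≥-shift : ∀ t (g : Fin r → List ℕ) → #≥ (suc t) (map suc (concat (tabulate g))) ≡ Σℕ.sum (λ j → #≥ t (g j))
  #≥-shift t g = trans (#≥-map-suc t (concat (tabulate g))) (#≥-concat-tabulate t g)

  #≥-root : ∀ (T : Tree r) →
    #≥ 0 (leafDepths T) + #≥ 0 (internalDepths T) ≡ suc (#≥ 1 (leafDepths T) + #≥ 1 (internalDepths T))
  #≥-root leaf = refl
  #≥-root (node f) = begin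
    #≥ 0 (map suc X) + suc (#≥ 0 (map suc Y))  ≡⟨ ℕ.+-suc _ _ ⟩
    suc (#≥ 0 (map suc X) + #≥ 0 (map suc Y))  ≡⟨ cong suc (cong₂ _+_ (#≥-0-map-suc X) (#≥-0-map-suc Y)) ⟩
    suc (#≥ 1 (map suc X) + #≥ 1 (map suc Y))  ∎
    where
    open ≡-Reasoning
    X = concat (tabulate (leafDepths ∘ f))
    Y = concat (tabulate (internalDepths ∘ f))

  #≥-children : ∀ t (T : Tree r) →
    #≥ (suc t) (leafDepths T) + #≥ (suc t) (internalDepths T) ≡ r * #≥ t (internalDepths T)
  #≥-children t leaf = sym (ℕ.*-zeroʳ r)
  #≥-children t (node f) = begin
    #≥ (suc t) (leafDepths (node f)) + #≥ (suc t) (internalDepths (node f))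
      ≡⟨ cong₂ _+_ (#≥-shift t (leafDepths ∘ f)) (#≥-shift t (internalDepths ∘ f)) ⟩
    Σℕ.sum (λ j → #≥ t (leafDepths (f j))) + Σℕ.sum (λ j → #≥ t (internalDepths (f j)))
      ≡⟨ Σℕ.∑-distrib-+ (λ j → #≥ t (leafDepths (f j))) _ ⟨
    Σℕ.sum (λ j → #≥ t (leafDepths (f j)) + #≥ t (internalDepths (f j)))
      ≡⟨ subtrees t ⟩
    r * #≥ t (internalDepths (node f)) ∎
    where
    open ≡-Reasoning
    subtrees : ∀ t → Σℕ.sum (λ j → #≥ t (leafDepths (f j)) + #≥ t (internalDepths (f j)))
                     ≡ r * #≥ t (internalDepths (node f))
    subtrees zero = begin
      Σℕ.sum (λ j → #≥ 0 (leafDepths (f j)) + #≥ 0 (internalDepths (f j)))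
        ≡⟨ Σℕ.sum-cong-≗ (λ j → trans (#≥-root (f j)) (cong suc (#≥-children 0 (f j)))) ⟩
      Σℕ.sum (λ j → 1 + r * #≥ 0 (internalDepths (f j)))
        ≡⟨ Σℕ.∑-distrib-+ (λ _ → 1) (λ j → r * #≥ 0 (internalDepths (f j))) ⟩
      Σℕ.sum {r} (λ _ → 1) + Σℕ.sum (λ j → r * #≥ 0 (internalDepths (f j)))
        ≡⟨ cong₂ _+_ (∑-one r) (sym (Σℕ.*-distribˡ-sum r (λ j → #≥ 0 (internalDepths (f j))))) ⟩
      r + r * Σℕ.sum (λ j → #≥ 0 (internalDepths (f j)))
        ≡⟨ ℕ.*-suc r _ ⟨
      r * suc (Σℕ.sum (λ j → #≥ 0 (internalDepths (f j))))
        ≡⟨ cong (λ n → r * suc n) (trans (#≥-0-map-suc Y) (#≥-shift 0 (internalDepths ∘ f))) ⟨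
      r * #≥ 0 (internalDepths (node f)) ∎
      where Y = concat (tabulate (internalDepths ∘ f))
    subtrees (suc t) = begin
      Σℕ.sum (λ j → #≥ (suc t) (leafDepths (f j)) + #≥ (suc t) (internalDepths (f j)))
        ≡⟨ Σℕ.sum-cong-≗ (λ j → #≥-children t (f j)) ⟩
      Σℕ.sum (λ j → r * #≥ t (internalDepths (f j)))
        ≡⟨ Σℕ.*-distribˡ-sum r (λ j → #≥ t (internalDepths (f j))) ⟨
      r * Σℕ.sum (λ j → #≥ t (internalDepths (f j)))
        ≡⟨ cong (r *_) (#≥-shift t (internalDepths ∘ f)) ⟨
      r * #≥ (suc t) (internalDepths (node f)) ∎

  #≥-leaves : ∀ t (T : Tree r) →
    r * #≥ t (internalDepths T) ∸ #≥ (suc t) (internalDepths T) ≡ #≥ (suc t) (leafDepths T)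
  #≥-leaves t T = trans (cong (_∸ #≥ (suc t) (internalDepths T)) (sym (#≥-children t T)))
                        (ℕ.m+n∸n≡m _ (#≥ (suc t) (internalDepths T)))

∸-toℕ : ∀ {h} (k : Fin h) → h ∸ toℕ k ≡ suc (h ∸ suc (toℕ k))
∸-toℕ {suc h} zero = refl
∸-toℕ {suc h} (suc k) = ∸-toℕ k

module _ {r n : ℕ} (p : Fin n → ℚ) (T : Tree r) (h : ℕ) where

  -- Level k (root at level h) holds the leaves of depth h ∸ k; layer π k selects the weights
  -- that π places at level ≤ k.
  layer : Permutation n (length (leafDepths T)) → Fin h → Fin n → Bool
  layer π k j = h ∸ toℕ k ≤ᵇ lookup (leafDepths T) (π ⟨$⟩ʳ j)

  assignCost-layers : height T ≤ h → ∀ π → assignCost T p π ≡ ∑[ k < h ] selectSum p (layer π k)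
  assignCost-layers height≤h π =
    trans (sumℚ-tabulate (λ j → p j Q.* ℕtoℚ (lookup (leafDepths T) (π ⟨$⟩ʳ j))))
          (layer-cake h p _ depth≤h)
    where
    depth≤h : ∀ j → lookup (leafDepths T) (π ⟨$⟩ʳ j) ≤ h
    depth≤h j = ℕ.≤-trans (All.lookup (leafDepths≤height T) (∈-lookup (π ⟨$⟩ʳ j))) height≤h

  formula-layers : ∀ i → Represents T h i → ∀ π → formula r p h i ≡ ∑[ k < h ] S p (count (layer π k))
  formula-layers i rep π = trans (sumℚ-tabulate {h} (λ k → S p (r * i (suc (toℕ k)) ∸ i (toℕ k))))
                                 (sum-cong-≗ {h} (cong (S p) ∘ layer-size))
    where
    I = internalDepths T
    L = leafDepths T
    i≡#≥ : ∀ k → k ≤ h → i k ≡ #≥ (h ∸ k) I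
    i≡#≥ k k≤h = trans (rep k k≤h) (length-filter-≤-map-∸ h k I)
    layer-size : ∀ k → r * i (suc (toℕ k)) ∸ i (toℕ k) ≡ count (layer π k)
    layer-size k = begin
      r * i (suc (toℕ k)) ∸ i (toℕ k)
        ≡⟨ cong₂ (λ a b → r * a ∸ b) (i≡#≥ (suc (toℕ k)) (F.toℕ<n k)) (i≡#≥ (toℕ k) (ℕ.<⇒≤ (F.toℕ<n k))) ⟩
      r * #≥ t I ∸ #≥ (h ∸ toℕ k) I
        ≡⟨ cong (λ u → r * #≥ t I ∸ #≥ u I) (∸-toℕ k) ⟩
      r * #≥ t I ∸ #≥ (suc t) I
        ≡⟨ #≥-leaves t T ⟩
      #≥ (suc t) L
        ≡⟨ cong (λ u → #≥ u L) (∸-toℕ k) ⟨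
      #≥ (h ∸ toℕ k) L
        ≡⟨ trans (count-permute _ π) (#≥-lookup (h ∸ toℕ k) L) ⟨
      count (layer π k) ∎
      where
      open ≡-Reasoning
      t = h ∸ suc (toℕ k)

lemma6 : (r n : ℕ) → 2 ≤ r → 2 ≤ n →
    (p : Fin n → ℚ) → (∀ j → 0ℚ Q.≤ p j) → (∀ j k → j F.≤ k → p j Q.≤ p k) →
    (T : Tree r) → length (leafDepths T) ≡ n →
    (h : ℕ) → height T ≤ h → (i : ℕ → ℕ) → Represents T h i →
    (Σ (Permutation n (length (leafDepths T))) (λ π → assignCost T p π ≡ formula r p h i))
    × ((π : Permutation n (length (leafDepths T))) → formula r p h i Q.≤ assignCost T p π)
lemma6 r n _ _ p _ p-sorted T refl h height≤h i rep = (σ , σ-optimal) , lower-bound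
  where
  open Q.≤-Reasoning
  sorted = sortDescending n (lookup (leafDepths T))
  σ = proj₁ sorted
  layer-closed : ∀ k → DownwardClosed (layer p T h σ k)
  layer-closed k j≤j′ holds = ℕ.≤⇒≤ᵇ (ℕ.≤-trans (ℕ.≤ᵇ⇒≤ (h ∸ toℕ k) _ holds) (proj₂ sorted j≤j′))
  σ-optimal : assignCost T p σ ≡ formula r p h i
  σ-optimal = begin-equality
    assignCost T p σ                           ≡⟨ assignCost-layers p T h height≤h σ ⟩
    ∑[ k < h ] selectSum p (layer p T h σ k)   ≡⟨ sum-cong-≗ {h} (λ k → S-count≡selectSum p _ (layer-closed k)) ⟨
    ∑[ k < h ] S p (count (layer p T h σ k))   ≡⟨ formula-layers p T h i rep σ ⟨
    formula r p h i                            ∎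
  lower-bound : ∀ π → formula r p h i Q.≤ assignCost T p π
  lower-bound π = begin
    formula r p h i                            ≡⟨ formula-layers p T h i rep π ⟩
    ∑[ k < h ] S p (count (layer p T h π k))   ≤⟨ sum-mono-≤ (λ k → S-count≤selectSum p (p-sorted _ _) (layer p T h π k)) ⟩
    ∑[ k < h ] selectSum p (layer p T h π k)   ≡⟨ assignCost-layers p T h height≤h π ⟨
    assignCost T p π                           ∎
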